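{- For every $n\ge1$ the following hold over $\mathfrak{DT}_n$: (i) $\mathsf{rtop}(T)=\mathsf{rlop}(T)$ for every $T\in\mathfrak{DT}_n$; (ii) the five statistics $\mathsf{riop},\mathsf{iop},\mathsf{top},\mathsf{pop},\mathsf{rpop}$ are all equidistributed over $\mathfrak{DT}_n$, i.e. for every $j$ the numbers $|\{T\in\mathfrak{DT}_n:\mathsf{st}(T)=j\}|$ coincide for $\mathsf{st}\in\{\mathsf{riop},\mathsf{iop},\mathsf{top},\mathsf{pop},\mathsf{rpop}\}$. Moreover, for $n\ge5$ the distribution of $\mathsf{lop}$ over $\mathfrak{DT}_n$ differs from the distribution of each of the other seven statistics $\mathsf{iop},\mathsf{riop},\mathsf{top},\mathsf{rtop},\mathsf{pop},\mathsf{rpop},\mathsf{rlop}$.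
   Context: A di-sk tree is a rooted binary tree (each node has at most one left child and at most one right child) whose nodes are labeled $\oplus$ or $\ominus$, such that no node has the same label as its right child. $\mathfrak{DT}_n$ is the set of di-sk trees with $n-1$ nodes. For a traversal order of the nodes of $T$, the number of initial $\oplus$-nodes is the number of nodes visited before the first $\ominus$-node (or the total number of nodes if $T$ has no $\ominus$-node). Define, for each of the following traversal orders, the corresponding statistic counting initial $\oplus$-nodes: inorder (left subtree, root, right subtree, recursively): $\mathsf{iop}$; right inorder (right subtree, root, left subtree): $\mathsf{riop}$; preorder (root, left subtree, right subtree): $\mathsf{top}$; right preorder (root, right subtree, left subtree): $\mathsf{rtop}$; postorder (left subtree, right subtree, root): $\mathsf{pop}$; right postorder (right subtree, left subtree, root): $\mathsf{rpop}$; level order (levels from the root downward, each level from left to right): $\mathsf{lop}$; right level order (levels from the root downward, each level from right to left): $\mathsf{rlop}$. -}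

module Defs where

open import Data.Nat using (ℕ; zero; suc; _+_; _∸_)
import Data.Nat as N
open import Data.Bool using (Bool; true; false; _∧_; not)
import Data.Bool as B
open import Data.List using (List; []; _∷_; _++_; concatMap; filter; length; reverse; upTo)
open import Relation.Binary.PropositionalEquality using (_≡_)

data Label : Set where
  ⊕ ⊖ : Label

_==ᴸ_ : Label → Label → Bool
⊕ ==ᴸ ⊕ = true
⊖ ==ᴸ ⊖ = true
_ ==ᴸ _ = false

data Tree : Set where
  leaf : Tree
  node : Label → Tree → Tree → Tree

size : Tree → ℕ
size leaf = 0
size (node _ l r) = suc (size l + size r)

isDiSk : Tree → Bool
isDiSk leaf = true
isDiSk (node a l leaf) = isDiSk l
isDiSk (node a l (node b rl rr)) = not (a ==ᴸ b) ∧ isDiSk l ∧ isDiSk (node b rl rr)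

-- ofSize f k : all labeled binary trees with exactly k nodes, each exactly once,
-- provided the fuel f satisfies k ≤ f (fuel only guarantees structural recursion;
-- subtrees of a k-node tree have < k nodes)
ofSize : ℕ → ℕ → List Tree
ofSize _ zero = leaf ∷ []
ofSize zero (suc k) = []
ofSize (suc f) (suc k) =
  concatMap (λ i → concatMap (λ a → concatMap (λ l → concatMap (λ r → node a l r ∷ [])
      (ofSize f (k ∸ i))) (ofSize f i)) (⊕ ∷ ⊖ ∷ [])) (upTo (suc k))

-- 𝔇𝔗 n : list of all di-sk trees with n - 1 nodes (each exactly once)
DT : ℕ → List Tree
DT n = filter (λ T → isDiSk T B.≟ true) (ofSize (n ∸ 1) (n ∸ 1))

inorder rinorder preorder rpreorder postorder rpostorder : Tree → List Label
inorder leaf = []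
inorder (node a l r) = inorder l ++ (a ∷ inorder r)
rinorder leaf = []
rinorder (node a l r) = rinorder r ++ (a ∷ rinorder l)
preorder leaf = []
preorder (node a l r) = a ∷ (preorder l ++ preorder r)
rpreorder leaf = []
rpreorder (node a l r) = a ∷ (rpreorder r ++ rpreorder l)
postorder leaf = []
postorder (node a l r) = postorder l ++ (postorder r ++ (a ∷ []))
rpostorder leaf = []
rpostorder (node a l r) = rpostorder r ++ (rpostorder l ++ (a ∷ []))

zipLevels : List (List Label) → List (List Label) → List (List Label)
zipLevels [] ys = ys
zipLevels (x ∷ xs) [] = x ∷ xs
zipLevels (x ∷ xs) (y ∷ ys) = (x ++ y) ∷ zipLevels xs ys

levels : Tree → List (List Label)
levels leaf = []
levels (node a l r) = (a ∷ []) ∷ zipLevels (levels l) (levels r)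

concatL : List (List Label) → List Label
concatL [] = []
concatL (x ∷ xs) = x ++ concatL xs

levelorder rlevelorder : Tree → List Label
levelorder T = concatL (levels T)
rlevelorder T = concatL (Data.List.map reverse (levels T))
  where import Data.List

initPlus : List Label → ℕ
initPlus [] = 0
initPlus (⊕ ∷ xs) = suc (initPlus xs)
initPlus (⊖ ∷ xs) = 0

iop riop top rtop pop rpop lop rlop : Tree → ℕ
iop T = initPlus (inorder T)
riop T = initPlus (rinorder T)
top T = initPlus (preorder T)
rtop T = initPlus (rpreorder T)
pop T = initPlus (postorder T)
rpop T = initPlus (rpostorder T)
lop T = initPlus (levelorder T)
rlop T = initPlus (rlevelorder T)

count : (Tree → ℕ) → ℕ → ℕ → ℕ
count st n j = length (filter (λ T → st T N.≟ j) (DT n))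

EquiDist : (Tree → ℕ) → (Tree → ℕ) → ℕ → Set
EquiDist st st' n = (j : ℕ) → count st n j ≡ count st' n j

-- Each statistic counts the initial ⊕-nodes of a traversal, so equidistribution follows from
-- size- and di-sk-preserving bijections that carry the ⊕-prefix of one traversal to that of
-- another. Reversing every right chain turns preorder into reverse inorder and inorder into
-- reverse postorder. Writing a tree as U[a(⊕ᵏ, R)], where ⊕ᵏ is the ⊕-chain at the bottom of
-- its left spine, two recursive maps move ⊕ᵏ to the top and so carry the inorder and the
-- postorder prefix to the preorder prefix. rtop = rlop pointwise, since a right child of a
-- ⊕-root is a ⊖-node. For n ≥ 5, lop T = 1 forces rtop T = 1 and top T = 2 forces lop T = 2,
-- while the tree ⊕(⊕ⁿ⁻³, ⊖) violates both converses, so the counts differ.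

module Submission where

open import Defs
open import Data.Nat using (ℕ; zero; suc; _+_; _∸_; _≤_; _<_; z≤n; s≤s)
import Data.Nat as ℕ
open import Data.Nat.Properties
open import Data.Nat.Solver using (module +-*-Solver)
open +-*-Solver using (solve; _:+_; _:=_; con)
open import Data.Bool.Properties using (∧-conicalˡ; ∧-conicalʳ)
open import Data.Bool using (true; _∧_)
import Data.Bool as Bool
open import Data.List using (List; []; _∷_; _++_; [_]; map; concatMap; cartesianProductWith; filter; length; upTo)
open import Data.List.Properties using (length-++; ++-assoc; ++-identityʳ; concatMap-cong)
open import Data.List.Membership.Propositional using (_∈_; find; lose)
open import Data.List.Membership.Propositional.Properties
  using (∈-∃++; ∈-++⁺ˡ; ∈-++⁺ʳ; ∈-++⁻; ∈-concatMap⁺; ∈-concatMap⁻; ∈-cartesianProductWith⁺; ∈-cartesianProductWith⁻;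
         ∈-upTo⁺; ∈-upTo⁻; ∈-filter⁺; ∈-filter⁻)
open import Data.List.Relation.Binary.Disjoint.Propositional using (Disjoint)
open import Data.List.Relation.Unary.Any using (here; there)
open import Data.List.Relation.Unary.All as All using ([]; _∷_)
import Data.List.Relation.Unary.All.Properties as All
import Data.List.Relation.Unary.AllPairs as AllPairs
import Data.List.Relation.Unary.AllPairs.Properties as AllPairs
open import Data.List.Relation.Unary.Unique.Propositional using (Unique; []; _∷_)
import Data.List.Relation.Unary.Unique.Propositional.Properties as Unique
open import Data.Product using (∃; ∃₂; _×_; _,_; proj₁)
open import Data.Sum using (inj₁; inj₂)
open import Data.Empty using (⊥; ⊥-elim)
open import Data.Unit using (⊤; tt)
open import Function using (_∘_)
open import Relation.Nullary using (¬_; yes; no)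
open import Relation.Unary using (Decidable)
open import Relation.Unary.Properties using (∁?)
open import Relation.Binary.PropositionalEquality using (_≡_; _≢_; refl; sym; trans; cong; cong₂; subst; module ≡-Reasoning)

private
  variable
    A B C : Set

length-≤-of-injection : (f : A → B) {xs : List A} {ys : List B} → Unique xs →
  (∀ {x} → x ∈ xs → f x ∈ ys) → (∀ {x y} → x ∈ xs → y ∈ xs → f x ≡ f y → x ≡ y) →
  length xs ≤ length ys
length-≤-of-injection f {[]} _ _ _ = z≤n
length-≤-of-injection f {x ∷ xs} (x∉xs ∷ xs!) into inj
  with as , bs , refl ← ∈-∃++ (into (here refl)) = begin
    suc (length xs)              ≤⟨ s≤s (length-≤-of-injection f xs! into′ (λ p q → inj (there p) (there q))) ⟩
    suc (length (as ++ bs))      ≡⟨ cong suc (length-++ as) ⟩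
    suc (length as + length bs)  ≡⟨ +-suc (length as) (length bs) ⟨
    length as + length (f x ∷ bs) ≡⟨ length-++ as ⟨
    length (as ++ f x ∷ bs)      ∎
  where
  open ≤-Reasoning
  into′ : ∀ {y} → y ∈ xs → f y ∈ as ++ bs
  into′ y∈xs with ∈-++⁻ as (into (there y∈xs))
  ... | inj₁ p = ∈-++⁺ˡ p
  ... | inj₂ (here eq) = ⊥-elim (All.lookup x∉xs y∈xs (inj (here refl) (there y∈xs) (sym eq)))
  ... | inj₂ (there p) = ∈-++⁺ʳ as p

Unique-concatMap⁺ : {h : A → List B} (key : B → A) → (∀ {x y} → y ∈ h x → key y ≡ x) →
  (∀ x → Unique (h x)) → ∀ {xs} → Unique xs → Unique (concatMap h xs)
Unique-concatMap⁺ {h = h} key key-h h! {xs} xs! =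
  Unique.concat⁺ (All.map⁺ (All.universal h! xs)) (AllPairs.map⁺ (AllPairs.map disjoint xs!))
  where
  disjoint : ∀ {x y} → x ≢ y → Disjoint (h x) (h y)
  disjoint x≢y (p , q) = x≢y (trans (sym (key-h p)) (key-h q))

concatMap-singletons : (f : A → B → C) (xs : List A) (ys : List B) →
  concatMap (λ x → concatMap (λ y → [ f x y ]) ys) xs ≡ cartesianProductWith f xs ys
concatMap-singletons f [] ys = refl
concatMap-singletons f (x ∷ xs) ys = cong₂ _++_ (singletons ys) (concatMap-singletons f xs ys)
  where
  singletons : ∀ ys → concatMap (λ y → [ f x y ]) ys ≡ map (f x) ys
  singletons [] = refl
  singletons (y ∷ ys) = cong (f x y ∷_) (singletons ys)

length-filter-+-∁ : {R : A → Set} (R? : Decidable R) (xs : List A) →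
  length (filter R? xs) + length (filter (∁? R?) xs) ≡ length xs
length-filter-+-∁ R? [] = refl
length-filter-+-∁ R? (x ∷ xs) with R? x
... | yes _ = cong suc (length-filter-+-∁ R? xs)
... | no _ = trans (+-suc _ _) (cong suc (length-filter-+-∁ R? xs))

-- The complements are compared as well, so that an injection of xs into itself suffices.
length-filter-transport : {P Q : A → Set} (P? : Decidable P) (Q? : Decidable Q)
  (f : A → A) {xs : List A} → Unique xs →
  (∀ {x} → x ∈ xs → f x ∈ xs) → (∀ {x y} → x ∈ xs → y ∈ xs → f x ≡ f y → x ≡ y) →
  (∀ {x} → x ∈ xs → P x → Q (f x)) → (∀ {x} → x ∈ xs → Q (f x) → P x) →
  length (filter P? xs) ≡ length (filter Q? xs)
length-filter-transport P? Q? f {xs} xs! into inj P⇒Q Q⇒P =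
  ≤-antisym P≤Q (+-cancelʳ-≤ (length (filter (∁? Q?) xs)) _ _ (begin
    length (filter Q? xs) + length (filter (∁? Q?) xs) ≡⟨ length-filter-+-∁ Q? xs ⟩
    length xs                                         ≡⟨ length-filter-+-∁ P? xs ⟨
    length (filter P? xs) + length (filter (∁? P?) xs) ≤⟨ +-monoʳ-≤ (length (filter P? xs)) ∁P≤∁Q ⟩
    length (filter P? xs) + length (filter (∁? Q?) xs) ∎))
  where
  open ≤-Reasoning
  restrict : ∀ {R S} (R? : Decidable R) (S? : Decidable S) →
    (∀ {x} → x ∈ xs → R x → S (f x)) → length (filter R? xs) ≤ length (filter S? xs)
  restrict R? S? R⇒S = length-≤-of-injection f (Unique.filter⁺ R? xs!)
    (λ p → let x∈ , Rx = ∈-filter⁻ R? p in ∈-filter⁺ S? (into x∈) (R⇒S x∈ Rx))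
    (λ p q → inj (proj₁ (∈-filter⁻ R? p)) (proj₁ (∈-filter⁻ R? q)))
  P≤Q = restrict P? Q? P⇒Q
  ∁P≤∁Q = restrict (∁? P?) (∁? Q?) (λ x∈ ¬Px Qfx → ¬Px (Q⇒P x∈ Qfx))

module _ {P Q : A → Set} (P? : Decidable P) (Q? : Decidable Q) where

  length-filter-mono : ∀ xs → (∀ {x} → x ∈ xs → P x → Q x) → length (filter P? xs) ≤ length (filter Q? xs)
  length-filter-mono [] _ = z≤n
  length-filter-mono (x ∷ xs) P⇒Q with ih ← length-filter-mono xs (P⇒Q ∘ there) | P? x | Q? x
  ... | yes _ | yes _ = s≤s ih
  ... | yes Px | no ¬Qx = ⊥-elim (¬Qx (P⇒Q (here refl) Px))
  ... | no _ | yes _ = m≤n⇒m≤1+n ih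
  ... | no _ | no _ = ih

  length-filter-< : ∀ xs → (∀ {x} → x ∈ xs → P x → Q x) → ∀ {w} → w ∈ xs → Q w → ¬ P w →
    length (filter P? xs) < length (filter Q? xs)
  length-filter-< (x ∷ xs) P⇒Q (here refl) Qw ¬Pw with P? x | Q? x
  ... | yes Pw | _ = ⊥-elim (¬Pw Pw)
  ... | no _ | no ¬Qw = ⊥-elim (¬Qw Qw)
  ... | no _ | yes _ = s≤s (length-filter-mono xs (P⇒Q ∘ there))
  length-filter-< (x ∷ xs) P⇒Q (there w∈xs) Qw ¬Pw
    with ih ← length-filter-< xs (P⇒Q ∘ there) w∈xs Qw ¬Pw | P? x | Q? x
  ... | yes _ | yes _ = s≤s ih
  ... | yes Px | no ¬Qx = ⊥-elim (¬Qx (P⇒Q (here refl) Px))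
  ... | no _ | yes _ = m≤n⇒m≤1+n ih
  ... | no _ | no _ = ih

initPlus-++-⊖ : ∀ xs {ys} → initPlus (xs ++ ⊖ ∷ ys) ≡ initPlus xs
initPlus-++-⊖ [] = refl
initPlus-++-⊖ (⊕ ∷ xs) = cong suc (initPlus-++-⊖ xs)
initPlus-++-⊖ (⊖ ∷ xs) = refl

initPlus-++-⊖∈ : ∀ xs {ys} → ⊖ ∈ xs → initPlus (xs ++ ys) ≡ initPlus xs
initPlus-++-⊖∈ (⊖ ∷ xs) _ = refl
initPlus-++-⊖∈ (⊕ ∷ xs) (there ⊖∈xs) = cong suc (initPlus-++-⊖∈ xs ⊖∈xs)

_≢root_ : Label → Tree → Set
⊕ ≢root node ⊕ _ _ = ⊥
⊖ ≢root node ⊖ _ _ = ⊥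
_ ≢root _ = ⊤

data DiSk : Tree → Set where
  leaf : DiSk leaf
  node : ∀ {a l r} → a ≢root r → DiSk l → DiSk r → DiSk (node a l r)

≢root-leaf : ∀ a → a ≢root leaf
≢root-leaf ⊕ = tt
≢root-leaf ⊖ = tt

isDiSk⇒DiSk : ∀ t → isDiSk t ≡ true → DiSk t
isDiSk⇒DiSk leaf _ = leaf
isDiSk⇒DiSk (node a l leaf) h = node (≢root-leaf a) (isDiSk⇒DiSk l h) leaf
isDiSk⇒DiSk (node ⊕ l (node ⊕ _ _)) ()
isDiSk⇒DiSk (node ⊖ l (node ⊖ _ _)) ()
isDiSk⇒DiSk (node ⊕ l r@(node ⊖ _ _)) h =
  node tt (isDiSk⇒DiSk l (∧-conicalˡ _ _ h)) (isDiSk⇒DiSk r (∧-conicalʳ (isDiSk l) _ h))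
isDiSk⇒DiSk (node ⊖ l r@(node ⊕ _ _)) h =
  node tt (isDiSk⇒DiSk l (∧-conicalˡ _ _ h)) (isDiSk⇒DiSk r (∧-conicalʳ (isDiSk l) _ h))

DiSk⇒isDiSk : ∀ {t} → DiSk t → isDiSk t ≡ true
DiSk⇒isDiSk leaf = refl
DiSk⇒isDiSk (node {r = leaf} _ dl _) = DiSk⇒isDiSk dl
DiSk⇒isDiSk (node {⊕} {r = node ⊖ _ _} _ dl dr) = cong₂ _∧_ (DiSk⇒isDiSk dl) (DiSk⇒isDiSk dr)
DiSk⇒isDiSk (node {⊖} {r = node ⊕ _ _} _ dl dr) = cong₂ _∧_ (DiSk⇒isDiSk dl) (DiSk⇒isDiSk dr)

labels : List Label
labels = ⊕ ∷ ⊖ ∷ []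

rootLabel : Tree → Label
rootLabel leaf = ⊕
rootLabel (node a _ _) = a

leftSubtree : Tree → Tree
leftSubtree leaf = leaf
leftSubtree (node _ l _) = l

ofSizeSplit : ℕ → ℕ → ℕ → Label → List Tree
ofSizeSplit f k i a = cartesianProductWith (node a) (ofSize f i) (ofSize f (k ∸ i))

ofSizeWithLeft : ℕ → ℕ → ℕ → List Tree
ofSizeWithLeft f k i = concatMap (ofSizeSplit f k i) labels

ofSize-suc : ∀ f k → ofSize (suc f) (suc k) ≡ concatMap (ofSizeWithLeft f k) (upTo (suc k))
ofSize-suc f k = concatMap-cong
  (λ i → concatMap-cong (λ a → concatMap-singletons (node a) (ofSize f i) (ofSize f (k ∸ i))) labels)
  (upTo (suc k))

∈-ofSize-suc⁻ : ∀ f k {t} → t ∈ ofSize (suc f) (suc k) →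
  ∃ λ i → i < suc k × ∃₂ λ a l → ∃ λ r → l ∈ ofSize f i × r ∈ ofSize f (k ∸ i) × t ≡ node a l r
∈-ofSize-suc⁻ f k {t} t∈
  with i , i∈ , t∈ᵢ ← find (∈-concatMap⁻ (ofSizeWithLeft f k) {xs = upTo (suc k)} (subst (t ∈_) (ofSize-suc f k) t∈))
  with a , _ , t∈ₐ ← find (∈-concatMap⁻ (ofSizeSplit f k i) {xs = labels} t∈ᵢ)
  with l , r , l∈ , r∈ , refl ← ∈-cartesianProductWith⁻ (node a) (ofSize f i) (ofSize f (k ∸ i)) t∈ₐ
  = i , ∈-upTo⁻ i∈ , a , l , r , l∈ , r∈ , refl

∈-ofSize-suc⁺ : ∀ f k {i} a {l r} → i < suc k → l ∈ ofSize f i → r ∈ ofSize f (k ∸ i) →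
  node a l r ∈ ofSize (suc f) (suc k)
∈-ofSize-suc⁺ f k {i} a {l} {r} i<1+k l∈ r∈ = subst (node a l r ∈_) (sym (ofSize-suc f k))
  (∈-concatMap⁺ (ofSizeWithLeft f k) {xs = upTo (suc k)} (lose (∈-upTo⁺ i<1+k)
    (∈-concatMap⁺ (ofSizeSplit f k i) {xs = labels} (lose (label∈labels a)
      (∈-cartesianProductWith⁺ (node a) l∈ r∈)))))
  where
  label∈labels : ∀ a → a ∈ labels
  label∈labels ⊕ = here refl
  label∈labels ⊖ = there (here refl)

size-∈-ofSize : ∀ f k {t} → t ∈ ofSize f k → size t ≡ k
size-∈-ofSize f zero (here refl) = refl
size-∈-ofSize zero (suc k) ()
size-∈-ofSize (suc f) (suc k) t∈ with i , i<1+k , a , l , r , l∈ , r∈ , refl ← ∈-ofSize-suc⁻ f k t∈ =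
  cong suc (trans (cong₂ _+_ (size-∈-ofSize f i l∈) (size-∈-ofSize f (k ∸ i) r∈)) (m+[n∸m]≡n (≤-pred i<1+k)))

∈-ofSize : ∀ {f} t → size t ≤ f → t ∈ ofSize f (size t)
∈-ofSize leaf _ = here refl
∈-ofSize {suc f} (node a l r) (s≤s |t|≤f) =
  ∈-ofSize-suc⁺ f (size l + size r) a (s≤s (m≤m+n (size l) (size r)))
    (∈-ofSize l (≤-trans (m≤m+n (size l) (size r)) |t|≤f))
    (subst (λ k → r ∈ ofSize f k) (sym (m+n∸m≡n (size l) (size r)))
      (∈-ofSize r (≤-trans (m≤n+m (size r) (size l)) |t|≤f)))

ofSize-unique : ∀ f k → Unique (ofSize f k)
ofSize-unique f zero = [] ∷ []
ofSize-unique zero (suc k) = []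
ofSize-unique (suc f) (suc k) rewrite ofSize-suc f k =
  Unique-concatMap⁺ (size ∘ leftSubtree) (left-size _)
    (λ i → Unique-concatMap⁺ rootLabel (root-label i)
      (λ a → Unique.cartesianProductWith⁺ (node a) (λ { refl → refl , refl })
        (ofSize-unique f i) (ofSize-unique f (k ∸ i)))
      (((λ ()) ∷ []) ∷ [] ∷ []))
    (Unique.upTo⁺ (suc k))
  where
  root-label : ∀ i {a t} → t ∈ ofSizeSplit f k i a → rootLabel t ≡ a
  root-label i {a} t∈
    with _ , _ , _ , _ , refl ← ∈-cartesianProductWith⁻ (node a) (ofSize f i) (ofSize f (k ∸ i)) t∈ = refl
  left-size : ∀ i {t} → t ∈ ofSizeWithLeft f k i → size (leftSubtree t) ≡ i
  left-size i t∈
    with a , _ , t∈ₐ ← find (∈-concatMap⁻ (ofSizeSplit f k i) {xs = labels} t∈)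
    with _ , _ , l∈ , _ , refl ← ∈-cartesianProductWith⁻ (node a) (ofSize f i) (ofSize f (k ∸ i)) t∈ₐ =
    size-∈-ofSize f i l∈

∈-DT⁻ : ∀ {n t} → t ∈ DT n → DiSk t × size t ≡ n ∸ 1
∈-DT⁻ {n} t∈ with t∈ofSize , diSk ← ∈-filter⁻ (λ T → isDiSk T Bool.≟ true) {xs = ofSize (n ∸ 1) (n ∸ 1)} t∈ =
  isDiSk⇒DiSk _ diSk , size-∈-ofSize (n ∸ 1) (n ∸ 1) t∈ofSize

∈-DT⁺ : ∀ {n t} → DiSk t → size t ≡ n ∸ 1 → t ∈ DT n
∈-DT⁺ {n} {t} diSk |t| =
  ∈-filter⁺ (λ T → isDiSk T Bool.≟ true) (subst (λ k → t ∈ ofSize k k) |t| (∈-ofSize t ≤-refl)) (DiSk⇒isDiSk diSk)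

DT-unique : ∀ n → Unique (DT n)
DT-unique n = Unique.filter⁺ (λ T → isDiSk T Bool.≟ true) (ofSize-unique (n ∸ 1) (n ∸ 1))

EquiDist-via : ∀ {st st′} (to from : Tree → Tree) → (∀ {t} → DiSk t → DiSk (to t)) →
  (∀ t → size (to t) ≡ size t) → (∀ {t} → DiSk t → from (to t) ≡ t) →
  (∀ {t} → DiSk t → st′ (to t) ≡ st t) → ∀ n → EquiDist st st′ n
EquiDist-via {st} {st′} to from DiSk-to size-to from-to st′-to n j =
  length-filter-transport (λ T → st T ℕ.≟ j) (λ T → st′ T ℕ.≟ j) to (DT-unique n)
    (λ t∈ → let diSk , |t| = ∈-DT⁻ {n} t∈ in ∈-DT⁺ {n} (DiSk-to diSk) (trans (size-to _) |t|))
    (λ t∈ u∈ eq → trans (sym (from-to (diSk t∈))) (trans (cong from eq) (from-to (diSk u∈))))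
    (λ t∈ eq → trans (st′-to (diSk t∈)) eq)
    (λ t∈ eq → trans (sym (st′-to (diSk t∈))) eq)
  where
  diSk : ∀ {t} → t ∈ DT n → DiSk t
  diSk = proj₁ ∘ ∈-DT⁻ {n}

EquiDist-via-fuel : ∀ {st st′} (to from : ℕ → Tree → Tree) → (∀ f {t} → DiSk t → DiSk (to f t)) →
  (∀ f t → size (to f t) ≡ size t) → (∀ f {t} → DiSk t → size t ≤ f → from f (to f t) ≡ t) →
  (∀ f {t} → DiSk t → size t ≤ f → st′ (to f t) ≡ st t) → ∀ n → EquiDist st st′ n
EquiDist-via-fuel to from DiSk-to size-to from-to st′-to =
  EquiDist-via (λ t → to (size t) t) (λ u → from (size u) u) (DiSk-to _) (λ t → size-to _ t)
    (λ {t} d → subst (λ f → from f (to (size t) t) ≡ t) (sym (size-to _ t)) (from-to _ d ≤-refl))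
    (λ d → st′-to _ d ≤-refl)

mutual
  reverseRightChains : Tree → Tree
  reverseRightChains t = reverseOnto leaf t

  reverseOnto : Tree → Tree → Tree
  reverseOnto A leaf = A
  reverseOnto A (node a l r) = reverseOnto (node a (reverseRightChains l) A) r

graftʳ : Tree → Tree → Tree
graftʳ leaf B = B
graftʳ (node a l r) B = node a l (graftʳ r B)

graftʳ-leaf : ∀ t → graftʳ t leaf ≡ t
graftʳ-leaf leaf = refl
graftʳ-leaf (node a l r) = cong (node a l) (graftʳ-leaf r)

mutual
  reverseRightChains-involutive : ∀ t → reverseRightChains (reverseRightChains t) ≡ t
  reverseRightChains-involutive t = trans (reverseOnto-reverseOnto t leaf leaf) (graftʳ-leaf t)

  reverseOnto-reverseOnto : ∀ t B A → reverseOnto B (reverseOnto A t) ≡ reverseOnto (graftʳ t B) A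
  reverseOnto-reverseOnto leaf B A = refl
  reverseOnto-reverseOnto (node a l r) B A =
    trans (reverseOnto-reverseOnto r B (node a (reverseRightChains l) A))
      (cong (λ l′ → reverseOnto (node a l′ (graftʳ r B)) A) (reverseRightChains-involutive l))

mutual
  size-reverseRightChains : ∀ t → size (reverseRightChains t) ≡ size t
  size-reverseRightChains = size-reverseOnto leaf

  size-reverseOnto : ∀ A t → size (reverseOnto A t) ≡ size A + size t
  size-reverseOnto A leaf = sym (+-identityʳ (size A))
  size-reverseOnto A (node a l r) = begin
    size (reverseOnto (node a (reverseRightChains l) A) r)   ≡⟨ size-reverseOnto _ r ⟩
    suc (size (reverseRightChains l) + size A) + size r      ≡⟨ cong (λ m → suc (m + size A) + size r)
                                                                    (size-reverseRightChains l) ⟩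
    suc (size l + size A + size r)                           ≡⟨ solve 3 (λ l A r → con 1 :+ (l :+ A :+ r)
                                                                      := A :+ (con 1 :+ (l :+ r)))
                                                                    refl (size l) (size A) (size r) ⟩
    size A + suc (size l + size r)                           ∎
    where open ≡-Reasoning

mutual
  rinorder-reverseRightChains : ∀ t → rinorder (reverseRightChains t) ≡ preorder t
  rinorder-reverseRightChains = rinorder-reverseOnto leaf

  rinorder-reverseOnto : ∀ A t → rinorder (reverseOnto A t) ≡ rinorder A ++ preorder t
  rinorder-reverseOnto A leaf = sym (++-identityʳ (rinorder A))
  rinorder-reverseOnto A (node a l r) = begin
    rinorder (reverseOnto (node a (reverseRightChains l) A) r)        ≡⟨ rinorder-reverseOnto _ r ⟩
    (rinorder A ++ a ∷ rinorder (reverseRightChains l)) ++ preorder r ≡⟨ ++-assoc (rinorder A) _ (preorder r) ⟩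
    rinorder A ++ a ∷ rinorder (reverseRightChains l) ++ preorder r   ≡⟨ cong (λ xs → rinorder A ++ a ∷ xs ++ preorder r)
                                                                           (rinorder-reverseRightChains l) ⟩
    rinorder A ++ a ∷ preorder l ++ preorder r                        ∎
    where open ≡-Reasoning

mutual
  rpostorder-reverseRightChains : ∀ t → rpostorder (reverseRightChains t) ≡ inorder t
  rpostorder-reverseRightChains = rpostorder-reverseOnto leaf

  rpostorder-reverseOnto : ∀ A t → rpostorder (reverseOnto A t) ≡ rpostorder A ++ inorder t
  rpostorder-reverseOnto A leaf = sym (++-identityʳ (rpostorder A))
  rpostorder-reverseOnto A (node a l r) = begin
    rpostorder (reverseOnto (node a (reverseRightChains l) A) r)          ≡⟨ rpostorder-reverseOnto _ r ⟩
    (rpostorder A ++ rpostorder (reverseRightChains l) ++ [ a ]) ++ inorder r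
      ≡⟨ ++-assoc (rpostorder A) _ (inorder r) ⟩
    rpostorder A ++ (rpostorder (reverseRightChains l) ++ [ a ]) ++ inorder r
      ≡⟨ cong (rpostorder A ++_) (++-assoc (rpostorder (reverseRightChains l)) [ a ] (inorder r)) ⟩
    rpostorder A ++ rpostorder (reverseRightChains l) ++ a ∷ inorder r
      ≡⟨ cong (λ xs → rpostorder A ++ xs ++ a ∷ inorder r) (rpostorder-reverseRightChains l) ⟩
    rpostorder A ++ inorder l ++ a ∷ inorder r                             ∎
    where open ≡-Reasoning

_≢roots_ : Tree → Tree → Set
leaf ≢roots _ = ⊤
node b _ _ ≢roots t = b ≢root t

≢roots-node⇒≢root : ∀ A a {l r} → A ≢roots node a l r → a ≢root A
≢roots-node⇒≢root leaf ⊕ _ = tt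
≢roots-node⇒≢root leaf ⊖ _ = tt
≢roots-node⇒≢root (node ⊕ _ _) ⊖ _ = tt
≢roots-node⇒≢root (node ⊖ _ _) ⊕ _ = tt

mutual
  DiSk-reverseRightChains : ∀ {t} → DiSk t → DiSk (reverseRightChains t)
  DiSk-reverseRightChains d = DiSk-reverseOnto leaf d tt

  DiSk-reverseOnto : ∀ {A t} → DiSk A → DiSk t → A ≢roots t → DiSk (reverseOnto A t)
  DiSk-reverseOnto dA leaf _ = dA
  DiSk-reverseOnto {A} dA (node {a} a≢r dl dr) A≢t =
    DiSk-reverseOnto (node (≢roots-node⇒≢root A a A≢t) (DiSk-reverseRightChains dl) dA) dr a≢r

⊕-chain : ℕ → Tree
⊕-chain zero = leaf
⊕-chain (suc k) = node ⊕ (⊕-chain k) leaf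

graftˡ : Tree → Tree → Tree
graftˡ leaf X = X
graftˡ (node a l r) X = node a (graftˡ l X) r

size-⊕-chain : ∀ k → size (⊕-chain k) ≡ k
size-⊕-chain zero = refl
size-⊕-chain (suc k) = cong suc (trans (+-identityʳ _) (size-⊕-chain k))

size-graftˡ : ∀ U X → size (graftˡ U X) ≡ size U + size X
size-graftˡ leaf X = refl
size-graftˡ (node a l r) X = cong suc (begin
  size (graftˡ l X) + size r  ≡⟨ cong (_+ size r) (size-graftˡ l X) ⟩
  size l + size X + size r    ≡⟨ solve 3 (λ l x r → l :+ x :+ r := l :+ r :+ x) refl (size l) (size X) (size r) ⟩
  size l + size r + size X    ∎)
  where open ≡-Reasoning

size-graftˡ-node : ∀ P c Q S → size (graftˡ P (node c Q S)) ≡ suc (size P + size Q + size S)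
size-graftˡ-node P c Q S = trans (size-graftˡ P _)
  (solve 3 (λ p q s → p :+ (con 1 :+ (q :+ s)) := con 1 :+ (p :+ q :+ s)) refl (size P) (size Q) (size S))

size-<-graftˡ : ∀ P c Q S → size S < size (graftˡ P (node c Q S))
size-<-graftˡ P c Q S = begin-strict
  size S                          <⟨ s≤s (m≤n+m (size S) (size P + size Q)) ⟩
  suc (size P + size Q + size S)  ≡⟨ size-graftˡ-node P c Q S ⟨
  size (graftˡ P (node c Q S))    ∎
  where open ≤-Reasoning

size-rightLeft-< : ∀ P c Q b Rl Rr → size Rl < size (graftˡ P (node c Q (node b Rl Rr)))
size-rightLeft-< P c Q b Rl Rr =
  <-trans (s≤s (m≤m+n (size Rl) (size Rr))) (size-<-graftˡ P c Q (node b Rl Rr))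

DiSk-⊕-chain : ∀ k → DiSk (⊕-chain k)
DiSk-⊕-chain zero = leaf
DiSk-⊕-chain (suc k) = node tt (DiSk-⊕-chain k) leaf

DiSk-graftˡ⁺ : ∀ {U X} → DiSk U → DiSk X → DiSk (graftˡ U X)
DiSk-graftˡ⁺ leaf dX = dX
DiSk-graftˡ⁺ (node a≢r dl dr) dX = node a≢r (DiSk-graftˡ⁺ dl dX) dr

DiSk-graftˡ⁻ : ∀ U {X} → DiSk (graftˡ U X) → DiSk U × DiSk X
DiSk-graftˡ⁻ leaf dX = leaf , dX
DiSk-graftˡ⁻ (node a l r) (node a≢r dl dr) = let dU , dX = DiSk-graftˡ⁻ l dl in node a≢r dU dr , dX

inorder-graftˡ : ∀ U X → inorder (graftˡ U X) ≡ inorder X ++ inorder U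
inorder-graftˡ leaf X = sym (++-identityʳ (inorder X))
inorder-graftˡ (node a l r) X =
  trans (cong (_++ a ∷ inorder r) (inorder-graftˡ l X)) (++-assoc (inorder X) (inorder l) _)

postorder-graftˡ : ∀ U X → postorder (graftˡ U X) ≡ postorder X ++ postorder U
postorder-graftˡ leaf X = sym (++-identityʳ (postorder X))
postorder-graftˡ (node a l r) X =
  trans (cong (_++ postorder r ++ [ a ]) (postorder-graftˡ l X)) (++-assoc (postorder X) (postorder l) _)

initPlus-inorder-⊕-chain : ∀ k ys → initPlus (inorder (⊕-chain k) ++ ys) ≡ k + initPlus ys
initPlus-inorder-⊕-chain zero ys = refl
initPlus-inorder-⊕-chain (suc k) ys = begin
  initPlus ((inorder (⊕-chain k) ++ [ ⊕ ]) ++ ys) ≡⟨ cong initPlus (++-assoc (inorder (⊕-chain k)) [ ⊕ ] ys) ⟩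
  initPlus (inorder (⊕-chain k) ++ ⊕ ∷ ys)        ≡⟨ initPlus-inorder-⊕-chain k (⊕ ∷ ys) ⟩
  k + suc (initPlus ys)                           ≡⟨ +-suc k (initPlus ys) ⟩
  suc k + initPlus ys                             ∎
  where open ≡-Reasoning

postorder-⊕-chain : ∀ k → postorder (⊕-chain k) ≡ inorder (⊕-chain k)
postorder-⊕-chain zero = refl
postorder-⊕-chain (suc k) = cong (_++ [ ⊕ ]) (postorder-⊕-chain k)

top-graftˡ-⊕-chain : ∀ k E → top (graftˡ (⊕-chain k) E) ≡ k + top E
top-graftˡ-⊕-chain zero E = refl
top-graftˡ-⊕-chain (suc k) E =
  cong suc (trans (cong initPlus (++-identityʳ _)) (top-graftˡ-⊕-chain k E))

top-⊕-chain : ∀ k → top (⊕-chain k) ≡ k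
top-⊕-chain zero = refl
top-⊕-chain (suc k) = cong suc (trans (cong initPlus (++-identityʳ _)) (top-⊕-chain k))

iop-⊕-chain : ∀ k → iop (⊕-chain k) ≡ k
iop-⊕-chain k =
  trans (cong initPlus (sym (++-identityʳ _))) (trans (initPlus-inorder-⊕-chain k []) (+-identityʳ k))

iop-graftˡ : ∀ U a k R → iop (graftˡ U (node a (⊕-chain k) R)) ≡ k + initPlus (a ∷ inorder R ++ inorder U)
iop-graftˡ U a k R = begin
  initPlus (inorder (graftˡ U (node a (⊕-chain k) R)))           ≡⟨ cong initPlus (inorder-graftˡ U _) ⟩
  initPlus ((inorder (⊕-chain k) ++ a ∷ inorder R) ++ inorder U) ≡⟨ cong initPlus (++-assoc (inorder (⊕-chain k)) _ _) ⟩
  initPlus (inorder (⊕-chain k) ++ a ∷ inorder R ++ inorder U)   ≡⟨ initPlus-inorder-⊕-chain k _ ⟩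
  k + initPlus (a ∷ inorder R ++ inorder U)                      ∎
  where open ≡-Reasoning

pop-graftˡ : ∀ U a k R →
  pop (graftˡ U (node a (⊕-chain k) R)) ≡ k + initPlus ((postorder R ++ [ a ]) ++ postorder U)
pop-graftˡ U a k R = begin
  initPlus (postorder (graftˡ U (node a (⊕-chain k) R)))
    ≡⟨ cong initPlus (postorder-graftˡ U _) ⟩
  initPlus ((postorder (⊕-chain k) ++ postorder R ++ [ a ]) ++ postorder U)
    ≡⟨ cong initPlus (++-assoc (postorder (⊕-chain k)) _ _) ⟩
  initPlus (postorder (⊕-chain k) ++ (postorder R ++ [ a ]) ++ postorder U)
    ≡⟨ cong (λ xs → initPlus (xs ++ (postorder R ++ [ a ]) ++ postorder U)) (postorder-⊕-chain k) ⟩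
  initPlus (inorder (⊕-chain k) ++ (postorder R ++ [ a ]) ++ postorder U)
    ≡⟨ initPlus-inorder-⊕-chain k _ ⟩
  k + initPlus ((postorder R ++ [ a ]) ++ postorder U) ∎
  where open ≡-Reasoning

-- A node labelled a with right subtree R ends the ⊕-chain at the bottom of a left spine.
Ends : Label → Tree → Set
Ends ⊕ leaf = ⊥
Ends _ _ = ⊤

data LeftSpine : Tree → Set where
  chain : ∀ k → LeftSpine (⊕-chain k)
  split : ∀ U a k R → Ends a R → LeftSpine (graftˡ U (node a (⊕-chain k) R))

leftSpine : ∀ t → LeftSpine t
leftSpine leaf = chain 0
leftSpine (node a l r) with leftSpine l
... | split U b k R e = split (node a U r) b k R e
... | chain k = extend a k r
  where
  extend : ∀ a k r → LeftSpine (node a (⊕-chain k) r)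
  extend ⊕ k leaf = chain (suc k)
  extend ⊕ k r@(node _ _ _) = split leaf ⊕ k r tt
  extend ⊖ k r = split leaf ⊖ k r tt

Starts : Tree → Set
Starts leaf = ⊥
Starts (node ⊕ _ leaf) = ⊥
Starts _ = ⊤

data TopChain : Tree → Set where
  chain : ∀ k → TopChain (⊕-chain k)
  graft : ∀ k E → Starts E → TopChain (graftˡ (⊕-chain k) E)

topChain : ∀ t → TopChain t
topChain leaf = chain 0
topChain (node ⊕ l leaf) with topChain l
... | chain k = chain (suc k)
... | graft k E s = graft (suc k) E s
topChain t@(node ⊕ _ (node _ _ _)) = graft 0 t tt
topChain t@(node ⊖ _ _) = graft 0 t tt

topChain-⊕-chain : ∀ k → topChain (⊕-chain k) ≡ chain k
topChain-⊕-chain zero = refl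
topChain-⊕-chain (suc k) rewrite topChain-⊕-chain k = refl

topChain-graftˡ : ∀ k E (s : Starts E) → topChain (graftˡ (⊕-chain k) E) ≡ graft k E s
topChain-graftˡ zero (node ⊕ _ (node _ _ _)) _ = refl
topChain-graftˡ zero (node ⊖ _ _) _ = refl
topChain-graftˡ (suc k) E s rewrite topChain-graftˡ k E s = refl

-- The recursive calls are on subtrees exposed only by a view, so these maps consume fuel;
-- fuel size t suffices (EquiDist-via-fuel).
inToPreFuel : ℕ → Tree → Tree
inToPreFuel zero t = t
inToPreFuel (suc f) t with leftSpine t
... | chain k = ⊕-chain k
... | split U ⊖ k R _ = graftˡ (⊕-chain k) (node ⊖ U R)
... | split U ⊕ k (node b Rl Rr) _ = graftˡ (⊕-chain k) (node ⊕ (inToPreFuel f Rl) (node b U Rr))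

preToInFuel : ℕ → Tree → Tree
preToInFuel zero t = t
preToInFuel (suc f) t with topChain t
... | chain k = ⊕-chain k
... | graft k (node ⊖ U R) _ = graftˡ U (node ⊖ (⊕-chain k) R)
... | graft k (node ⊕ X (node b U Rr)) _ = graftˡ U (node ⊕ (⊕-chain k) (node b (preToInFuel f X) Rr))

size-inToPreFuel : ∀ f t → size (inToPreFuel f t) ≡ size t
size-inToPreFuel zero t = refl
size-inToPreFuel (suc f) t with leftSpine t
... | chain k = refl
... | split U ⊖ k R _
  rewrite size-graftˡ-node (⊕-chain k) ⊖ U R | size-graftˡ-node U ⊖ (⊕-chain k) R =
  cong (λ m → suc (m + size R)) (+-comm (size (⊕-chain k)) (size U))
... | split U ⊕ k (node b Rl Rr) _
  rewrite size-graftˡ-node (⊕-chain k) ⊕ (inToPreFuel f Rl) (node b U Rr)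
        | size-graftˡ-node U ⊕ (⊕-chain k) (node b Rl Rr) | size-inToPreFuel f Rl =
  solve 4 (λ k u l r → con 1 :+ (k :+ l :+ (con 1 :+ (u :+ r))) := con 1 :+ (u :+ k :+ (con 1 :+ (l :+ r))))
    refl (size (⊕-chain k)) (size U) (size Rl) (size Rr)

DiSk-inToPreFuel : ∀ f {t} → DiSk t → DiSk (inToPreFuel f t)
DiSk-inToPreFuel zero d = d
DiSk-inToPreFuel (suc f) {t} d with leftSpine t
... | chain k = DiSk-⊕-chain k
... | split U ⊖ k R _ with dU , node ⊖≢R _ dR ← DiSk-graftˡ⁻ U d =
  DiSk-graftˡ⁺ (DiSk-⊕-chain k) (node ⊖≢R dU dR)
... | split U ⊕ k (node ⊖ Rl Rr) _ with dU , node _ _ (node ⊖≢Rr dRl dRr) ← DiSk-graftˡ⁻ U d =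
  DiSk-graftˡ⁺ (DiSk-⊕-chain k) (node tt (DiSk-inToPreFuel f dRl) (node ⊖≢Rr dU dRr))
... | split U ⊕ k (node ⊕ Rl Rr) _ with _ , node () _ _ ← DiSk-graftˡ⁻ U d

preToIn-inToPre : ∀ f t → size t ≤ f → preToInFuel f (inToPreFuel f t) ≡ t
preToIn-inToPre zero leaf _ = refl
preToIn-inToPre (suc f) t |t|≤ with leftSpine t
... | chain k rewrite topChain-⊕-chain k = refl
... | split U ⊖ k R _ rewrite topChain-graftˡ k (node ⊖ U R) tt = refl
... | split U ⊕ k (node b Rl Rr) _
  rewrite topChain-graftˡ k (node ⊕ (inToPreFuel f Rl) (node b U Rr)) tt =
  cong (λ X → graftˡ U (node ⊕ (⊕-chain k) (node b X Rr)))
    (preToIn-inToPre f Rl (≤-pred (≤-trans (size-rightLeft-< U ⊕ (⊕-chain k) b Rl Rr) |t|≤)))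

top-inToPreFuel : ∀ f {t} → DiSk t → size t ≤ f → top (inToPreFuel f t) ≡ iop t
top-inToPreFuel zero leaf _ = refl
top-inToPreFuel (suc f) {t} d |t|≤ with leftSpine t
... | chain k = trans (top-⊕-chain k) (sym (iop-⊕-chain k))
... | split U ⊖ k R _ = trans (top-graftˡ-⊕-chain k _) (sym (iop-graftˡ U ⊖ k R))
... | split U ⊕ k (node ⊕ Rl Rr) _ with _ , node () _ _ ← DiSk-graftˡ⁻ U d
... | split U ⊕ k (node ⊖ Rl Rr) _ with _ , node _ _ (node _ dRl _) ← DiSk-graftˡ⁻ U d = begin
  top (graftˡ (⊕-chain k) (node ⊕ X (node ⊖ U Rr)))          ≡⟨ top-graftˡ-⊕-chain k _ ⟩
  k + suc (initPlus (preorder X ++ ⊖ ∷ _))                   ≡⟨ cong (λ m → k + suc m) (initPlus-++-⊖ (preorder X)) ⟩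
  k + suc (top X)                                            ≡⟨ cong (λ m → k + suc m) (top-inToPreFuel f dRl |Rl|≤f) ⟩
  k + suc (iop Rl)                                           ≡⟨ cong (λ m → k + suc m) (initPlus-++-⊖ (inorder Rl)) ⟨
  k + suc (initPlus (inorder Rl ++ ⊖ ∷ inorder Rr ++ inorder U))
                                                             ≡⟨ cong (λ xs → k + suc (initPlus xs)) (++-assoc (inorder Rl) _ _) ⟨
  k + initPlus (⊕ ∷ inorder (node ⊖ Rl Rr) ++ inorder U)     ≡⟨ iop-graftˡ U ⊕ k (node ⊖ Rl Rr) ⟨
  iop (graftˡ U (node ⊕ (⊕-chain k) (node ⊖ Rl Rr)))          ∎
  where
  open ≡-Reasoning
  X = inToPreFuel f Rl
  |Rl|≤f = ≤-pred (≤-trans (size-rightLeft-< U ⊕ (⊕-chain k) ⊖ Rl Rr) |t|≤)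

opposite : Label → Label
opposite ⊕ = ⊖
opposite ⊖ = ⊕

swapLabels : Tree → Tree
swapLabels leaf = leaf
swapLabels (node a l r) = node (opposite a) (swapLabels l) (swapLabels r)

swapLabels-involutive : ∀ t → swapLabels (swapLabels t) ≡ t
swapLabels-involutive leaf = refl
swapLabels-involutive (node ⊕ l r) = cong₂ (node ⊕) (swapLabels-involutive l) (swapLabels-involutive r)
swapLabels-involutive (node ⊖ l r) = cong₂ (node ⊖) (swapLabels-involutive l) (swapLabels-involutive r)

size-swapLabels : ∀ t → size (swapLabels t) ≡ size t
size-swapLabels leaf = refl
size-swapLabels (node a l r) = cong suc (cong₂ _+_ (size-swapLabels l) (size-swapLabels r))

≢root-swapLabels : ∀ a t → a ≢root t → opposite a ≢root swapLabels t
≢root-swapLabels ⊕ leaf _ = tt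
≢root-swapLabels ⊖ leaf _ = tt
≢root-swapLabels ⊕ (node ⊖ _ _) _ = tt
≢root-swapLabels ⊖ (node ⊕ _ _) _ = tt

DiSk-swapLabels : ∀ {t} → DiSk t → DiSk (swapLabels t)
DiSk-swapLabels leaf = leaf
DiSk-swapLabels (node {a} {r = r} a≢r dl dr) =
  node (≢root-swapLabels a r a≢r) (DiSk-swapLabels dl) (DiSk-swapLabels dr)

-- Relabelling Y keeps the new right chain alternating.
hangRight : Tree → Tree → Tree
hangRight U leaf = node ⊖ U leaf
hangRight U (node b X Y) = node b X (node (opposite b) U (swapLabels Y))

unhangRight : Tree → Tree × Tree
unhangRight (node _ U leaf) = U , leaf
unhangRight (node b X (node _ U W)) = U , node b X (swapLabels W)
unhangRight leaf = leaf , leaf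

-- A leaf below the chain can only hang from a ⊖-node (see Ends).
parentLabel : Tree → Label
parentLabel leaf = ⊖
parentLabel (node a _ _) = opposite a

size-hangRight : ∀ U G → size (hangRight U G) ≡ suc (size U + size G)
size-hangRight U leaf = refl
size-hangRight U (node b X Y) rewrite size-swapLabels Y =
  solve 3 (λ u x y → con 1 :+ (x :+ (con 1 :+ (u :+ y))) := con 1 :+ (u :+ (con 1 :+ (x :+ y))))
    refl (size U) (size X) (size Y)

DiSk-hangRight : ∀ {U G} → DiSk U → DiSk G → DiSk (hangRight U G)
DiSk-hangRight dU leaf = node tt dU leaf
DiSk-hangRight {G = node ⊕ X Y} dU (node b≢Y dX dY) =
  node tt dX (node (≢root-swapLabels ⊕ Y b≢Y) dU (DiSk-swapLabels dY))
DiSk-hangRight {G = node ⊖ X Y} dU (node b≢Y dX dY) =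
  node tt dX (node (≢root-swapLabels ⊖ Y b≢Y) dU (DiSk-swapLabels dY))

starts-hangRight : ∀ U G → Starts (hangRight U G)
starts-hangRight U leaf = tt
starts-hangRight U (node ⊕ _ _) = tt
starts-hangRight U (node ⊖ _ _) = tt

unhangRight-hangRight : ∀ U G → unhangRight (hangRight U G) ≡ (U , G)
unhangRight-hangRight U leaf = refl
unhangRight-hangRight U (node b X Y) = cong (λ Y′ → U , node b X Y′) (swapLabels-involutive Y)

top-hangRight : ∀ U {G} → DiSk G → top (hangRight U G) ≡ top G
top-hangRight U leaf = refl
top-hangRight U (node {⊖} _ _ _) = refl
top-hangRight U (node {⊕} {X} {leaf} _ _ _) =
  cong suc (trans (initPlus-++-⊖ (preorder X)) (cong initPlus (sym (++-identityʳ (preorder X)))))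
top-hangRight U (node {⊕} {X} {node ⊖ _ _} _ _ _) =
  cong suc (trans (initPlus-++-⊖ (preorder X)) (sym (initPlus-++-⊖ (preorder X))))

parentLabel-≡ : ∀ a R → a ≢root R → Ends a R → parentLabel R ≡ a
parentLabel-≡ ⊖ leaf _ _ = refl
parentLabel-≡ ⊕ (node ⊖ _ _) _ _ = refl
parentLabel-≡ ⊖ (node ⊕ _ _) _ _ = refl

initPlus-postorder-++ : ∀ a R ys → a ≢root R → Ends a R →
  initPlus ((postorder R ++ [ a ]) ++ ys) ≡ pop R
initPlus-postorder-++ ⊖ leaf ys _ _ = refl
initPlus-postorder-++ ⊖ R@(node ⊕ _ _) ys _ _ =
  trans (cong initPlus (++-assoc (postorder R) [ ⊖ ] ys)) (initPlus-++-⊖ (postorder R))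
initPlus-postorder-++ ⊕ R@(node ⊖ x y) ys _ _ =
  trans (cong initPlus (++-assoc (postorder R) [ ⊕ ] ys))
    (initPlus-++-⊖∈ (postorder R) (∈-++⁺ʳ (postorder x) (∈-++⁺ʳ (postorder y) (here refl))))

postToPreFuel : ℕ → Tree → Tree
postToPreFuel zero t = t
postToPreFuel (suc f) t with leftSpine t
... | chain k = ⊕-chain k
... | split U _ k R _ = graftˡ (⊕-chain k) (hangRight U (postToPreFuel f R))

preToPostFuel : ℕ → Tree → Tree
preToPostFuel zero t = t
preToPostFuel (suc f) t with topChain t
... | chain k = ⊕-chain k
... | graft k E _ with unhangRight E
...   | U , G = graftˡ U (node (parentLabel R) (⊕-chain k) R)
  where R = preToPostFuel f G

size-postToPreFuel : ∀ f t → size (postToPreFuel f t) ≡ size t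
size-postToPreFuel zero t = refl
size-postToPreFuel (suc f) t with leftSpine t
... | chain k = refl
... | split U a k R _
  rewrite size-graftˡ (⊕-chain k) (hangRight U (postToPreFuel f R)) | size-hangRight U (postToPreFuel f R)
        | size-postToPreFuel f R | size-graftˡ-node U a (⊕-chain k) R =
  solve 3 (λ k u r → k :+ (con 1 :+ (u :+ r)) := con 1 :+ (u :+ k :+ r))
    refl (size (⊕-chain k)) (size U) (size R)

DiSk-postToPreFuel : ∀ f {t} → DiSk t → DiSk (postToPreFuel f t)
DiSk-postToPreFuel zero d = d
DiSk-postToPreFuel (suc f) {t} d with leftSpine t
... | chain k = DiSk-⊕-chain k
... | split U a k R _ with dU , node _ _ dR ← DiSk-graftˡ⁻ U d =
  DiSk-graftˡ⁺ (DiSk-⊕-chain k) (DiSk-hangRight dU (DiSk-postToPreFuel f dR))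

preToPost-postToPre : ∀ f {t} → DiSk t → size t ≤ f → preToPostFuel f (postToPreFuel f t) ≡ t
preToPost-postToPre zero leaf _ = refl
preToPost-postToPre (suc f) {t} d |t|≤ with leftSpine t
... | chain k rewrite topChain-⊕-chain k = refl
... | split U a k R ends with _ , node a≢R _ dR ← DiSk-graftˡ⁻ U d
  rewrite topChain-graftˡ k _ (starts-hangRight U (postToPreFuel f R))
        | unhangRight-hangRight U (postToPreFuel f R)
        | preToPost-postToPre f dR (≤-pred (≤-trans (size-<-graftˡ U a (⊕-chain k) R) |t|≤))
        | parentLabel-≡ a R a≢R ends = refl

top-postToPreFuel : ∀ f {t} → DiSk t → size t ≤ f → top (postToPreFuel f t) ≡ pop t
top-postToPreFuel zero leaf _ = refl
top-postToPreFuel (suc f) {t} d |t|≤ with leftSpine t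
... | chain k = trans (top-⊕-chain k) (sym (trans (cong initPlus (postorder-⊕-chain k)) (iop-⊕-chain k)))
... | split U a k R ends with _ , node a≢R _ dR ← DiSk-graftˡ⁻ U d = begin
  top (graftˡ (⊕-chain k) (hangRight U G))             ≡⟨ top-graftˡ-⊕-chain k _ ⟩
  k + top (hangRight U G)                              ≡⟨ cong (k +_) (top-hangRight U (DiSk-postToPreFuel f dR)) ⟩
  k + top G                                            ≡⟨ cong (k +_) (top-postToPreFuel f dR |R|≤f) ⟩
  k + pop R                                            ≡⟨ cong (k +_) (initPlus-postorder-++ a R _ a≢R ends) ⟨
  k + initPlus ((postorder R ++ [ a ]) ++ postorder U) ≡⟨ pop-graftˡ U a k R ⟨
  pop (graftˡ U (node a (⊕-chain k) R))                ∎
  where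
  open ≡-Reasoning
  G = postToPreFuel f R
  |R|≤f = ≤-pred (≤-trans (size-<-graftˡ U a (⊕-chain k) R) |t|≤)

zipLevels-[] : ∀ xss → zipLevels xss [] ≡ xss
zipLevels-[] [] = refl
zipLevels-[] (_ ∷ _) = refl

rtop≡rlop : ∀ {t} → DiSk t → rtop t ≡ rlop t
rtop≡rlop leaf = refl
rtop≡rlop (node {⊖} _ _ _) = refl
rtop≡rlop (node {⊕} {l} {leaf} _ dl _) rewrite zipLevels-[] (levels l) = cong suc (rtop≡rlop dl)
rtop≡rlop (node {⊕} {leaf} {node ⊖ _ _} _ _ _) = refl
rtop≡rlop (node {⊕} {node _ _ _} {node ⊖ _ _} _ _ _) = refl

EquiDist-top-riop : ∀ n → EquiDist top riop n
EquiDist-top-riop = EquiDist-via reverseRightChains reverseRightChains DiSk-reverseRightChains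
  size-reverseRightChains (λ {t} _ → reverseRightChains-involutive t)
  (λ {t} _ → cong initPlus (rinorder-reverseRightChains t))

EquiDist-iop-rpop : ∀ n → EquiDist iop rpop n
EquiDist-iop-rpop = EquiDist-via reverseRightChains reverseRightChains DiSk-reverseRightChains
  size-reverseRightChains (λ {t} _ → reverseRightChains-involutive t)
  (λ {t} _ → cong initPlus (rpostorder-reverseRightChains t))

EquiDist-iop-top : ∀ n → EquiDist iop top n
EquiDist-iop-top = EquiDist-via-fuel inToPreFuel preToInFuel DiSk-inToPreFuel size-inToPreFuel
  (λ f {t} _ → preToIn-inToPre f t) top-inToPreFuel

EquiDist-pop-top : ∀ n → EquiDist pop top n
EquiDist-pop-top = EquiDist-via-fuel postToPreFuel preToPostFuel DiSk-postToPreFuel size-postToPreFuel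
  preToPost-postToPre top-postToPreFuel

EquiDist-rtop-rlop : ∀ n → EquiDist rtop rlop n
EquiDist-rtop-rlop =
  EquiDist-via (λ t → t) (λ t → t) (λ d → d) (λ _ → refl) (λ _ → refl) (λ d → sym (rtop≡rlop d))

lop≡1⇒rtop≡1 : ∀ {t} → DiSk t → lop t ≡ 1 → rtop t ≡ 1
lop≡1⇒rtop≡1 (node {⊕} {r = node ⊖ _ _} _ _ _) _ = refl
lop≡1⇒rtop≡1 (node {⊕} {leaf} {leaf} _ _ _) _ = refl
lop≡1⇒rtop≡1 (node {⊕} {node ⊖ _ _} {leaf} _ _ _) _ = refl

top≡2⇒lop≡2 : ∀ {t} → DiSk t → top t ≡ 2 → lop t ≡ 2
top≡2⇒lop≡2 (node {⊕} {node ⊕ _ _} {node ⊖ _ _} _ _ _) _ = refl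
top≡2⇒lop≡2 (node {⊕} {node ⊕ leaf leaf} {leaf} _ _ _) _ = refl
top≡2⇒lop≡2 (node {⊕} {node ⊕ leaf (node ⊖ _ _)} {leaf} _ _ _) _ = refl
top≡2⇒lop≡2 (node {⊕} {node ⊕ (node ⊖ _ _) leaf} {leaf} _ _ _) _ = refl
top≡2⇒lop≡2 (node {⊕} {node ⊕ (node ⊖ _ _) (node _ _ _)} {leaf} _ _ _) _ = refl

-- lop = 2, top = m + 3 and rtop = 1.
separating : ℕ → Tree
separating m = node ⊕ (⊕-chain (2 + m)) (node ⊖ leaf leaf)

separating∈DT : ∀ m → separating m ∈ DT (5 + m)
separating∈DT m = ∈-DT⁺ {5 + m} (node tt (DiSk-⊕-chain (2 + m)) (node tt leaf leaf))
  (cong suc (trans (+-comm (size (⊕-chain (2 + m))) 1) (cong suc (size-⊕-chain (2 + m)))))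

count-top<count-lop : ∀ m → count top (5 + m) 2 < count lop (5 + m) 2
count-top<count-lop m = length-filter-< (λ T → top T ℕ.≟ 2) (λ T → lop T ℕ.≟ 2) (DT (5 + m))
  (λ T∈ → top≡2⇒lop≡2 (proj₁ (∈-DT⁻ {5 + m} T∈))) (separating∈DT m) refl (λ ())

count-lop<count-rtop : ∀ m → count lop (5 + m) 1 < count rtop (5 + m) 1
count-lop<count-rtop m = length-filter-< (λ T → lop T ℕ.≟ 1) (λ T → rtop T ℕ.≟ 1) (DT (5 + m))
  (λ T∈ → lop≡1⇒rtop≡1 (proj₁ (∈-DT⁻ {5 + m} T∈))) (separating∈DT m) refl (λ ())

lop-separated : ∀ {n} → 5 ≤ n → ¬ EquiDist lop top n × ¬ EquiDist lop rtop n
lop-separated (s≤s (s≤s (s≤s (s≤s (s≤s {n = m} _))))) =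
  (λ eq → <-irrefl (sym (eq 2)) (count-top<count-lop m)) ,
  (λ eq → <-irrefl (eq 1) (count-lop<count-rtop m))

theorem4p1 : (n : ℕ) → 1 ≤ n →
      ((T : Tree) → T ∈ DT n → rtop T ≡ rlop T)
    × (EquiDist riop iop n × EquiDist iop top n × EquiDist top pop n × EquiDist pop rpop n)
    × (5 ≤ n →
        ¬ EquiDist lop iop n × ¬ EquiDist lop riop n × ¬ EquiDist lop top n × ¬ EquiDist lop rtop n
        × ¬ EquiDist lop pop n × ¬ EquiDist lop rpop n × ¬ EquiDist lop rlop n)
theorem4p1 n _ =
  (λ T T∈ → rtop≡rlop (proj₁ (∈-DT⁻ {n} T∈))) ,
  ((λ j → trans (riop~top j) (sym (iop~top j))) , iop~top ,
   (λ j → sym (pop~top j)) , (λ j → trans (pop~top j) (sym (rpop~top j)))) ,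
  λ 5≤n → let ¬lop~top , ¬lop~rtop = lop-separated 5≤n in
    (λ h → ¬lop~top (λ j → trans (h j) (iop~top j))) ,
    (λ h → ¬lop~top (λ j → trans (h j) (riop~top j))) ,
    ¬lop~top ,
    ¬lop~rtop ,
    (λ h → ¬lop~top (λ j → trans (h j) (pop~top j))) ,
    (λ h → ¬lop~top (λ j → trans (h j) (rpop~top j))) ,
    (λ h → ¬lop~rtop (λ j → trans (h j) (sym (EquiDist-rtop-rlop n j))))
  where
  iop~top : EquiDist iop top n
  iop~top = EquiDist-iop-top n
  riop~top : EquiDist riop top n
  riop~top j = sym (EquiDist-top-riop n j)
  pop~top : EquiDist pop top n
  pop~top = EquiDist-pop-top n
  rpop~top : EquiDist rpop top n
  rpop~top j = trans (sym (EquiDist-iop-rpop n j)) (iop~top j)
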